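{- Let $n\ge 1$ and let $\mathcal F,\mathcal G\subset 2^{[n]}$ be down-sets with $|\mathcal F|\le|\mathcal G|$. Then there is a matching of $\mathcal F$ in the bipartite Kneser graph $KG(\mathcal F,\mathcal G)$ that covers every vertex of $\mathcal F$; equivalently, there is an injective map $\phi:\mathcal F\to\mathcal G$ such that $A\cap\phi(A)=\emptyset$ for every $A\in\mathcal F$.
   Context: $[n]=\{1,\dots,n\}$ and $2^{[n]}$ is its power set. A family $\mathcal B\subset 2^{[n]}$ is a down-set if $B\in\mathcal B$ and $A\subset B$ imply $A\in\mathcal B$. For families $\mathcal F,\mathcal G$, the bipartite Kneser graph $KG(\mathcal F,\mathcal G)$ has parts $\mathcal F$ and $\mathcal G$ (taken as separate copies) and an edge between $F\in\mathcal F$ and $G\in\mathcal G$ whenever $F\cap G=\emptyset$. -}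

module Defs where

open import Data.Nat using (ℕ; zero; suc)
open import Data.Bool using (Bool; true; false)
open import Data.List using (List; []; _∷_; map; _++_; filter; length)
open import Data.Vec using (Vec; []; _∷_)
open import Data.Fin.Subset using (Subset; _⊆_; _∩_; ⊥)
open import Relation.Binary.PropositionalEquality using (_≡_)
open import Relation.Nullary.Decidable using (yes; no)
open import Data.Bool using (_≟_)

Family : ℕ → Set
Family n = Subset n → Bool

_∈F_ : ∀ {n} → Subset n → Family n → Set
A ∈F 𝓕 = 𝓕 A ≡ true

IsDownSet : ∀ {n} → Family n → Set
IsDownSet {n} 𝓑 = ∀ (A B : Subset n) → B ∈F 𝓑 → A ⊆ B → A ∈F 𝓑

allSubsets : (n : ℕ) → List (Subset n)
allSubsets zero = [] ∷ []
allSubsets (suc n) = map (true ∷_) (allSubsets n) ++ map (false ∷_) (allSubsets n)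

card : ∀ {n} → Family n → ℕ
card {n} 𝓕 = length (filter (λ A → 𝓕 A ≟ true) (allSubsets n))

{-# OPTIONS --safe #-}

-- By Hall's theorem it suffices that |N(S)| ≥ |S| for every S ⊆ 𝓕.  The sets disjoint from
-- some member of S form a down-set 𝓓 with N(S) = 𝓖 ∩ 𝓓, and their complements form the up-set
-- 𝓤 generated by S, so S ⊆ 𝓕 ∩ 𝓤 and |𝓤| = |𝓓|.  Kleitman's inequalities (a down-set and an
-- up-set are negatively correlated, two down-sets positively) then give
--   2ⁿ|S| ≤ 2ⁿ|𝓕 ∩ 𝓤| ≤ |𝓕||𝓤| ≤ |𝓖||𝓓| ≤ 2ⁿ|𝓖 ∩ 𝓓| = 2ⁿ|N(S)|.
-- Hall's theorem is proved by deleting edges: at a vertex of degree ≥ 2 one of two edges can be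
-- deleted without violating Hall's condition, by submodularity of |N(·)|, and once every degree
-- is at most one the matching can be read off.

module Submission where

open import Defs
open import Data.Nat using (ℕ; zero; suc; _+_; _*_; _^_; _≤_; _<_; z≤n; s≤s; _≤?_)
open import Data.Nat.Properties
open import Data.Nat.Tactic.RingSolver using (solve-∀)
open import Algebra.Properties.CommutativeSemigroup +-commutativeSemigroup using (interchange)
open import Data.Bool using (Bool; true; false; _∧_; _∨_; not) renaming (_≟_ to _≟ᵇ_)
open import Data.List using (List; []; _∷_; _++_; map; filter; length; cartesianProduct)
open import Data.Bool.ListAction using (any)
open import Data.List.Membership.Propositional using (_∈_)
open import Data.List.Membership.Propositional.Properties
  using (∈-map⁺; ∈-++⁺ˡ; ∈-++⁺ʳ; ∈-filter⁺; ∈-filter⁻; ∈-cartesianProductWith⁺)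
open import Data.List.Relation.Unary.Any using (here; there; satisfied; any?)
open import Data.List.Relation.Unary.All using (all?)
import Data.List.Relation.Unary.All as All
open import Data.Vec using ([]; _∷_)
open import Data.Vec.Properties using (≡-dec)
open import Data.Fin.Subset using (Subset; _⊆_; _∩_; ⊥; ∁) renaming (_∈_ to _∈ˢ_)
open import Data.Fin.Subset.Properties
  using (s⊆s; out⊆; ⊆-refl; p⊆q⇒∁p⊇∁q; ∩-inverseʳ; Empty-unique; ∉⊥; x∈p∩q⁺; x∈p∩q⁻)
open import Data.List.Relation.Unary.All.Properties using (¬All⇒Any¬; ¬Any⇒All¬)
open import Data.Product using (Σ; ∃; _×_; _,_; proj₁; proj₂)
open import Data.Sum using (_⊎_; inj₁; inj₂)
open import Data.Empty using (⊥-elim)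
open import Relation.Binary.Definitions using (DecidableEquality)
open import Relation.Binary.PropositionalEquality
open import Relation.Nullary using (¬_; Dec; yes; no; does; _×-dec_)
open import Relation.Nullary.Decidable using (dec-true)

indicator : Bool → ℕ
indicator true = 1
indicator false = 0

∧-true⁻ : ∀ {a b} → a ∧ b ≡ true → a ≡ true × b ≡ true
∧-true⁻ {true} {true} _ = refl , refl

∧-true⁺ : ∀ {a b} → a ≡ true → b ≡ true → a ∧ b ≡ true
∧-true⁺ refl refl = refl

∨-true⁻ : ∀ {a b} → a ∨ b ≡ true → a ≡ true ⊎ b ≡ true
∨-true⁻ {true} _ = inj₁ refl
∨-true⁻ {false} e = inj₂ e

∨-trueˡ : ∀ {a} b → a ≡ true → a ∨ b ≡ true
∨-trueˡ b refl = refl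

∨-trueʳ : ∀ a {b} → b ≡ true → a ∨ b ≡ true
∨-trueʳ true _ = refl
∨-trueʳ false e = e

indicator-∨-∧ : ∀ a b → indicator (a ∨ b) + indicator (a ∧ b) ≡ indicator a + indicator b
indicator-∨-∧ true true = refl
indicator-∨-∧ true false = refl
indicator-∨-∧ false true = refl
indicator-∨-∧ false false = refl

module _ {X : Set} where

  _⊆ᵇ_ : (X → Bool) → (X → Bool) → Set
  p ⊆ᵇ q = ∀ x → p x ≡ true → q x ≡ true

  _∪ᵇ_ _∩ᵇ_ : (X → Bool) → (X → Bool) → X → Bool
  (p ∪ᵇ q) x = p x ∨ q x
  (p ∩ᵇ q) x = p x ∧ q x

  count : (X → Bool) → List X → ℕ
  count p [] = 0
  count p (x ∷ xs) = indicator (p x) + count p xs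

  count-mono : ∀ {p q} → p ⊆ᵇ q → ∀ xs → count p xs ≤ count q xs
  count-mono p⊆q [] = z≤n
  count-mono {p} {q} p⊆q (x ∷ xs) with p x in px | q x in qx
  ... | true  | true  = s≤s (count-mono p⊆q xs)
  ... | true  | false with () ← trans (sym (p⊆q x px)) qx
  ... | false | true  = m≤n⇒m≤1+n (count-mono p⊆q xs)
  ... | false | false = count-mono p⊆q xs

  count-∪-∩ : ∀ p q xs → count (p ∪ᵇ q) xs + count (p ∩ᵇ q) xs ≡ count p xs + count q xs
  count-∪-∩ p q [] = refl
  count-∪-∩ p q (x ∷ xs) = begin
    (∣x∪∣ + ∣xs∪∣) + (∣x∩∣ + ∣xs∩∣) ≡⟨ interchange ∣x∪∣ ∣xs∪∣ ∣x∩∣ ∣xs∩∣ ⟩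
    (∣x∪∣ + ∣x∩∣) + (∣xs∪∣ + ∣xs∩∣) ≡⟨ cong₂ _+_ (indicator-∨-∧ (p x) (q x)) (count-∪-∩ p q xs) ⟩
    (∣xp∣ + ∣xq∣) + (count p xs + count q xs) ≡⟨ interchange ∣xp∣ ∣xq∣ (count p xs) (count q xs) ⟩
    (∣xp∣ + count p xs) + (∣xq∣ + count q xs) ∎
    where
    open ≡-Reasoning
    ∣x∪∣ ∣x∩∣ ∣xs∪∣ ∣xs∩∣ ∣xp∣ ∣xq∣ : ℕ
    ∣x∪∣ = indicator (p x ∨ q x)
    ∣x∩∣ = indicator (p x ∧ q x)
    ∣xs∪∣ = count (p ∪ᵇ q) xs
    ∣xs∩∣ = count (p ∩ᵇ q) xs
    ∣xp∣ = indicator (p x)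
    ∣xq∣ = indicator (q x)

  count-⊆-∪ : ∀ {p} q r → p ⊆ᵇ (q ∪ᵇ r) → ∀ xs → count p xs ≤ count q xs + count r xs
  count-⊆-∪ {p} q r p⊆q∪r xs = begin
    count p xs                                   ≤⟨ count-mono p⊆q∪r xs ⟩
    count (q ∪ᵇ r) xs                            ≤⟨ m≤m+n _ _ ⟩
    count (q ∪ᵇ r) xs + count (q ∩ᵇ r) xs        ≡⟨ count-∪-∩ q r xs ⟩
    count q xs + count r xs                      ∎
    where open ≤-Reasoning

  count-pos⇒∃ : ∀ {p} xs → 1 ≤ count p xs → ∃ λ x → x ∈ xs × p x ≡ true
  count-pos⇒∃ {p} (x ∷ xs) pos with p x in px
  ... | true = x , here refl , px
  ... | false with y , y∈xs , py ← count-pos⇒∃ xs pos = y , there y∈xs , py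

  ∈⇒count-pos : ∀ {p x xs} → x ∈ xs → p x ≡ true → 1 ≤ count p xs
  ∈⇒count-pos (here refl) px rewrite px = s≤s z≤n
  ∈⇒count-pos {p} {xs = y ∷ xs} (there x∈xs) px = ≤-trans (∈⇒count-pos x∈xs px) (m≤n+m _ (indicator (p y)))

  distinct⇒count≥2 : ∀ {p x y xs} → x ∈ xs → y ∈ xs → x ≢ y → p x ≡ true → p y ≡ true → 2 ≤ count p xs
  distinct⇒count≥2 (here refl) (here refl) x≢y _ _ = ⊥-elim (x≢y refl)
  distinct⇒count≥2 (here refl) (there y∈xs) _ px py rewrite px = s≤s (∈⇒count-pos y∈xs py)
  distinct⇒count≥2 (there x∈xs) (here refl) _ px py rewrite py = s≤s (∈⇒count-pos x∈xs px)
  distinct⇒count≥2 {p} {xs = z ∷ xs} (there x∈xs) (there y∈xs) x≢y px py =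
    ≤-trans (distinct⇒count≥2 x∈xs y∈xs x≢y px py) (m≤n+m _ (indicator (p z)))

  count-< : ∀ {p q y} → p ⊆ᵇ q → ∀ {xs} → y ∈ xs → p y ≡ false → q y ≡ true → count p xs < count q xs
  count-< p⊆q {z ∷ xs} (here refl) py qy rewrite py | qy = s≤s (count-mono p⊆q xs)
  count-< {p} {q} p⊆q {z ∷ xs} (there y∈xs) py qy =
    +-mono-≤-< (indicator-mono (p z) (q z) (p⊆q z)) (count-< p⊆q y∈xs py qy)
    where
    indicator-mono : ∀ a b → (a ≡ true → b ≡ true) → indicator a ≤ indicator b
    indicator-mono true b a⇒b rewrite a⇒b refl = ≤-refl
    indicator-mono false b _ = z≤n

  count-++ : ∀ p xs ys → count p (xs ++ ys) ≡ count p xs + count p ys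
  count-++ p [] ys = refl
  count-++ p (x ∷ xs) ys = trans (cong (indicator (p x) +_) (count-++ p xs ys)) (sym (+-assoc (indicator (p x)) _ _))

  count-false : ∀ xs → count (λ _ → false) xs ≡ 0
  count-false [] = refl
  count-false (x ∷ xs) = count-false xs

  any-true⁺ : ∀ {p : X → Bool} {x xs} → x ∈ xs → p x ≡ true → any p xs ≡ true
  any-true⁺ (here refl) px = ∨-trueˡ _ px
  any-true⁺ {p} {xs = y ∷ xs} (there x∈xs) px = ∨-trueʳ (p y) (any-true⁺ x∈xs px)

  any-true⁻ : ∀ {p : X → Bool} xs → any p xs ≡ true → ∃ λ x → x ∈ xs × p x ≡ true
  any-true⁻ {p} (x ∷ xs) h with p x in px
  ... | true = x , here refl , px
  ... | false with y , y∈xs , py ← any-true⁻ xs h = y , there y∈xs , py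

  sublists : List X → List (List X)
  sublists [] = [] ∷ []
  sublists (x ∷ xs) = map (x ∷_) (sublists xs) ++ sublists xs

  filter-∈-sublists : ∀ (p : X → Bool) xs → filter (λ x → p x ≟ᵇ true) xs ∈ sublists xs
  filter-∈-sublists p [] = here refl
  filter-∈-sublists p (x ∷ xs) with p x
  ... | true = ∈-++⁺ˡ (∈-map⁺ (x ∷_) (filter-∈-sublists p xs))
  ... | false = ∈-++⁺ʳ (map (x ∷_) (sublists xs)) (filter-∈-sublists p xs)

count-map : ∀ {X Y : Set} (p : Y → Bool) (f : X → Y) xs → count p (map f xs) ≡ count (λ x → p (f x)) xs
count-map p f [] = refl
count-map p f (x ∷ xs) = cong (indicator (p (f x)) +_) (count-map p f xs)

-- Hall's theorem

-- The two sides of the bipartite graph are the subsets F and G of a single finite type X.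
module Hall {X : Set} (_≟_ : DecidableEquality X) (elements : List X)
  (∈-elements : ∀ x → x ∈ elements)
  (occurs-once : ∀ y → count (λ x → does (x ≟ y)) elements ≡ 1)
  (F G : X → Bool) where

  #_ : (X → Bool) → ℕ
  # p = count p elements

  ｛_｝ : X → X → Bool
  ｛ y ｝ x = does (x ≟ y)

  ∈｛｝ : ∀ x → ｛ x ｝ x ≡ true
  ∈｛｝ x = dec-true (x ≟ x) refl

  ∈｛｝⇒≡ : ∀ {x y} → ｛ y ｝ x ≡ true → x ≡ y
  ∈｛｝⇒≡ {x} {y} h with x ≟ y
  ... | yes x≡y = x≡y

  ｛｝⊆ᵇ : ∀ P {x} → P x ≡ true → ｛ x ｝ ⊆ᵇ P
  ｛｝⊆ᵇ P px z z∈｛x｝ = subst (λ w → P w ≡ true) (sym (∈｛｝⇒≡ z∈｛x｝)) px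

  ⊆｛｝⇒#≤1 : ∀ {p} y → p ⊆ᵇ ｛ y ｝ → # p ≤ 1
  ⊆｛｝⇒#≤1 {p} y p⊆y = subst (# p ≤_) (occurs-once y) (count-mono p⊆y elements)

  _∖｛_｝ : (X → Bool) → X → X → Bool
  (p ∖｛ y ｝) x = p x ∧ not (｛ y ｝ x)

  #≤#∖｛｝+1 : ∀ p y → # p ≤ # (p ∖｛ y ｝) + 1
  #≤#∖｛｝+1 p y = subst (# p ≤_) (cong (# (p ∖｛ y ｝) +_) (occurs-once y))
    (count-⊆-∪ (p ∖｛ y ｝) ｛ y ｝ split elements)
    where
    split : p ⊆ᵇ ((p ∖｛ y ｝) ∪ᵇ ｛ y ｝)
    split x px rewrite px with ｛ y ｝ x
    ... | true = refl
    ... | false = refl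

  ∈∖｛｝⁻ : ∀ p {y x} → (p ∖｛ y ｝) x ≡ true → p x ≡ true × x ≢ y
  ∈∖｛｝⁻ p {y} {x} h with px , x∉｛y｝ ← ∧-true⁻ {p x} h = px , λ { refl → x∉｛x｝ x∉｛y｝ }
    where
    x∉｛x｝ : ¬ not (｛ x ｝ x) ≡ true
    x∉｛x｝ h with () ← trans (sym (cong not (∈｛｝ x))) h

  two-distinct : ∀ {p} → 2 ≤ # p → ∃ λ y₁ → ∃ λ y₂ → y₁ ≢ y₂ × p y₁ ≡ true × p y₂ ≡ true
  two-distinct {p} 2≤#p with y₁ , _ , py₁ ← count-pos⇒∃ elements (≤-trans (s≤s z≤n) 2≤#p)
    with y₂ , _ , y₂∈p∖y₁ ← count-pos⇒∃ {p = p ∖｛ y₁ ｝} elements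
           (+-cancelʳ-≤ 1 1 _ (≤-trans 2≤#p (#≤#∖｛｝+1 p y₁)))
    with py₂ , y₂≢y₁ ← ∈∖｛｝⁻ p y₂∈p∖y₁
    = y₁ , y₂ , (λ y₁≡y₂ → y₂≢y₁ (sym y₁≡y₂)) , py₁ , py₂

  Adjacency : Set
  Adjacency = X → X → Bool

  neighbours : Adjacency → (X → Bool) → X → Bool
  neighbours a S y = G y ∧ any (λ x → S x ∧ a x y) elements

  HallCondition : Adjacency → Set
  HallCondition a = ∀ S → S ⊆ᵇ F → # S ≤ # (neighbours a S)

  Deficient : Adjacency → (X → Bool) → Set
  Deficient a S = S ⊆ᵇ F × # (neighbours a S) < # S

  Matching : Adjacency → Set
  Matching a = Σ ((x : X) → F x ≡ true → X) λ φ →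
    (∀ x p → G (φ x p) ≡ true × a x (φ x p) ≡ true) ×
    (∀ x x′ p p′ → φ x p ≡ φ x′ p′ → x ≡ x′)

  neighbours⁺ : ∀ a S {x y} → G y ≡ true → S x ≡ true → a x y ≡ true → neighbours a S y ≡ true
  neighbours⁺ a S {x} gy sx axy = ∧-true⁺ gy (any-true⁺ (∈-elements x) (∧-true⁺ sx axy))

  neighbours⁻ : ∀ a S {y} → neighbours a S y ≡ true →
    G y ≡ true × ∃ λ x → S x ≡ true × a x y ≡ true
  neighbours⁻ a S {y} h with gy , h′ ← ∧-true⁻ {G y} h with x , _ , sx∧axy ← any-true⁻ elements h′ =
    gy , x , ∧-true⁻ {S x} sx∧axy

  neighbours-mono : ∀ a {S T} → S ⊆ᵇ T → neighbours a S ⊆ᵇ neighbours a T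
  neighbours-mono a {S} {T} S⊆T y h with gy , x , sx , axy ← neighbours⁻ a S h =
    neighbours⁺ a T gy (S⊆T x sx) axy

  Matching-mono : ∀ {a b} → (∀ x y → b x y ≡ true → a x y ≡ true) → Matching b → Matching a
  Matching-mono b⊆a (φ , adjacent , injective) =
    φ , (λ x p → proj₁ (adjacent x p) , b⊆a x (φ x p) (proj₂ (adjacent x p))) , injective

  degree : Adjacency → X → ℕ
  degree a x = # (λ y → G y ∧ a x y)

  degree≤1⇒unique : ∀ a x {y z} → degree a x ≤ 1 →
    G y ≡ true → a x y ≡ true → G z ≡ true → a x z ≡ true → z ≡ y
  degree≤1⇒unique a x {y} {z} deg≤1 gy axy gz axz with z ≟ y
  ... | yes z≡y = z≡y
  ... | no z≢y = ⊥-elim (1+n≰n (≤-trans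
          (distinct⇒count≥2 (∈-elements z) (∈-elements y) z≢y (∧-true⁺ gz axz) (∧-true⁺ gy axy)) deg≤1))

  hall⇒neighbour : ∀ a → HallCondition a → ∀ x → F x ≡ true → ∃ λ y → G y ≡ true × a x y ≡ true
  hall⇒neighbour a hall-a x fx
    with y , _ , ny ← count-pos⇒∃ elements
           (subst (_≤ # (neighbours a ｛ x ｝)) (occurs-once x) (hall-a ｛ x ｝ (｛｝⊆ᵇ F fx)))
    with gy , x′ , x′∈｛x｝ , ax′y ← neighbours⁻ a ｛ x ｝ ny
    = y , gy , subst (λ v → a v y ≡ true) (∈｛｝⇒≡ x′∈｛x｝) ax′y

  -- With all degrees at most one, Hall's condition on singletons gives each vertex its unique
  -- neighbour, and on pairs it makes these neighbours distinct.
  degree≤1⇒matching : ∀ a → HallCondition a → (∀ x → F x ≡ true → degree a x ≤ 1) → Matching a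
  degree≤1⇒matching a hall-a deg≤1 = φ , adjacent , injective
    where
    φ : (x : X) → F x ≡ true → X
    φ x fx = proj₁ (hall⇒neighbour a hall-a x fx)

    adjacent : ∀ x fx → G (φ x fx) ≡ true × a x (φ x fx) ≡ true
    adjacent x fx = proj₂ (hall⇒neighbour a hall-a x fx)

    neighbour≡φ : ∀ x fx {z} → G z ≡ true → a x z ≡ true → z ≡ φ x fx
    neighbour≡φ x fx gz axz =
      degree≤1⇒unique a x (deg≤1 x fx) (proj₁ (adjacent x fx)) (proj₂ (adjacent x fx)) gz axz

    injective : ∀ x x′ fx fx′ → φ x fx ≡ φ x′ fx′ → x ≡ x′
    injective x x′ fx fx′ φx≡φx′ with x ≟ x′
    ... | yes x≡x′ = x≡x′
    ... | no x≢x′ = ⊥-elim (1+n≰n (≤-trans #pair≥2 (≤-trans (hall-a pair pair⊆F) #N≤1)))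
      where
      pair : X → Bool
      pair = ｛ x ｝ ∪ᵇ ｛ x′ ｝

      pair⊆F : pair ⊆ᵇ F
      pair⊆F z h with ∨-true⁻ {｛ x ｝ z} h
      ... | inj₁ z∈｛x｝ = ｛｝⊆ᵇ F fx z z∈｛x｝
      ... | inj₂ z∈｛x′｝ = ｛｝⊆ᵇ F fx′ z z∈｛x′｝

      #pair≥2 : 2 ≤ # pair
      #pair≥2 = distinct⇒count≥2 (∈-elements x) (∈-elements x′) x≢x′
        (∨-trueˡ _ (∈｛｝ x)) (∨-trueʳ (｛ x ｝ x′) (∈｛｝ x′))

      #N≤1 : # (neighbours a pair) ≤ 1
      #N≤1 = ⊆｛｝⇒#≤1 (φ x fx) N⊆｛φx｝
        where
        N⊆｛φx｝ : neighbours a pair ⊆ᵇ ｛ φ x fx ｝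
        N⊆｛φx｝ z nz with gz , w , w∈pair , awz ← neighbours⁻ a pair nz | ∨-true⁻ {｛ x ｝ w} w∈pair
        ... | inj₁ w∈｛x｝ rewrite ∈｛｝⇒≡ w∈｛x｝ = dec-true (z ≟ φ x fx) (neighbour≡φ x fx gz awz)
        ... | inj₂ w∈｛x′｝ rewrite ∈｛｝⇒≡ w∈｛x′｝ =
          dec-true (z ≟ φ x fx) (trans (neighbour≡φ x′ fx′ gz awz) (sym φx≡φx′))

  removeEdge : Adjacency → X → X → Adjacency
  removeEdge a x₀ y₀ x y = a x y ∧ not (｛ x₀ ｝ x ∧ ｛ y₀ ｝ y)

  removeEdge-⊆ : ∀ a x₀ y₀ x y → removeEdge a x₀ y₀ x y ≡ true → a x y ≡ true
  removeEdge-⊆ a x₀ y₀ x y h = proj₁ (∧-true⁻ {a x y} h)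

  removeEdge-keeps : ∀ a {x₀ y₀ x y} → x ≢ x₀ ⊎ y ≢ y₀ → a x y ≡ true → removeEdge a x₀ y₀ x y ≡ true
  removeEdge-keeps a {x₀} {y₀} {x} {y} ≢ axy rewrite axy with x ≟ x₀ | y ≟ y₀
  ... | no _     | _        = refl
  ... | yes _    | no _     = refl
  ... | yes x≡x₀ | yes y≡y₀ with ≢
  ...   | inj₁ x≢x₀ = ⊥-elim (x≢x₀ x≡x₀)
  ...   | inj₂ y≢y₀ = ⊥-elim (y≢y₀ y≡y₀)

  edges : Adjacency → X × X → Bool
  edges a (x , y) = F x ∧ (G y ∧ a x y)

  size : Adjacency → ℕ
  size a = count (edges a) (cartesianProduct elements elements)

  size-removeEdge : ∀ a {x₀ y₀} → F x₀ ≡ true → G y₀ ≡ true → a x₀ y₀ ≡ true →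
    size (removeEdge a x₀ y₀) < size a
  size-removeEdge a {x₀} {y₀} fx₀ gy₀ ax₀y₀ =
    count-< fewer (∈-cartesianProductWith⁺ _,_ (∈-elements x₀) (∈-elements y₀)) removed kept
    where
    fewer : edges (removeEdge a x₀ y₀) ⊆ᵇ edges a
    fewer (x , y) h with fx , gy∧rxy ← ∧-true⁻ {F x} h with gy , rxy ← ∧-true⁻ {G y} gy∧rxy =
      ∧-true⁺ fx (∧-true⁺ gy (removeEdge-⊆ a x₀ y₀ x y rxy))
    removed : edges (removeEdge a x₀ y₀) (x₀ , y₀) ≡ false
    removed rewrite fx₀ | gy₀ | ax₀y₀ | ∈｛｝ x₀ | ∈｛｝ y₀ = refl
    kept : edges a (x₀ , y₀) ≡ true
    kept rewrite fx₀ | gy₀ | ax₀y₀ = refl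

  degree≤1-or-branching : ∀ a → (∀ x → F x ≡ true → degree a x ≤ 1) ⊎ ∃ λ x → F x ≡ true × 2 ≤ degree a x
  degree≤1-or-branching a with any? (λ x → (F x ≟ᵇ true) ×-dec (2 ≤? degree a x)) elements
  ... | yes branching = inj₂ (satisfied branching)
  ... | no ¬branching = inj₁ λ x fx →
        ≤-pred (≰⇒> λ 2≤deg → All.lookup (¬Any⇒All¬ elements ¬branching) (∈-elements x) (fx , 2≤deg))

  _∈ᵇ_ : X → List X → Bool
  x ∈ᵇ ys = any ｛ x ｝ ys

  -- Every S ⊆ F coincides with F ∩ ys for some sublist ys of the enumeration.
  hallCondition-from-sublists : ∀ a →
    (∀ {ys} → ys ∈ sublists elements → # (F ∩ᵇ (_∈ᵇ ys)) ≤ # (neighbours a (F ∩ᵇ (_∈ᵇ ys)))) →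
    HallCondition a
  hallCondition-from-sublists a hall-sublists S S⊆F = begin
    # S                     ≤⟨ count-mono S⊆T elements ⟩
    # T                     ≤⟨ hall-sublists (filter-∈-sublists S elements) ⟩
    # (neighbours a T)      ≤⟨ count-mono (neighbours-mono a T⊆S) elements ⟩
    # (neighbours a S)      ∎
    where
    open ≤-Reasoning
    S? : (x : X) → Dec (S x ≡ true)
    S? x = S x ≟ᵇ true
    ys : List X
    ys = filter S? elements
    T : X → Bool
    T = F ∩ᵇ (_∈ᵇ ys)
    S⊆T : S ⊆ᵇ T
    S⊆T x sx = ∧-true⁺ (S⊆F x sx) (any-true⁺ (∈-filter⁺ S? (∈-elements x) sx) (∈｛｝ x))
    T⊆S : T ⊆ᵇ S
    T⊆S x tx with _ , x∈ys ← ∧-true⁻ {F x} tx with z , z∈ys , z∈｛x｝ ← any-true⁻ ys x∈ys =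
      subst (λ w → S w ≡ true) (∈｛｝⇒≡ z∈｛x｝) (proj₂ (∈-filter⁻ S? {xs = elements} z∈ys))

  hallCondition-or-deficient : ∀ a → HallCondition a ⊎ ∃ (Deficient a)
  hallCondition-or-deficient a
    with all? (λ ys → # (F ∩ᵇ (_∈ᵇ ys)) ≤? # (neighbours a (F ∩ᵇ (_∈ᵇ ys)))) (sublists elements)
  ... | yes hall-sublists = inj₁ (hallCondition-from-sublists a (All.lookup hall-sublists))
  ... | no ¬hall-sublists with ys , ¬hall ← satisfied (¬All⇒Any¬ (λ _ → _ ≤? _) _ ¬hall-sublists) =
        inj₂ (F ∩ᵇ (_∈ᵇ ys) , (λ x h → proj₁ (∧-true⁻ {F x} h)) , ≰⇒> ¬hall)

  deficient-after-removal-∋ : ∀ a {x₀ y₀ S} → HallCondition a → Deficient (removeEdge a x₀ y₀) S → S x₀ ≡ true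
  deficient-after-removal-∋ a {x₀} {y₀} {S} hall-a (S⊆F , deficient) with S x₀ in sx₀
  ... | true = refl
  ... | false = ⊥-elim (<-irrefl refl (<-≤-trans deficient (≤-trans (hall-a S S⊆F) (count-mono kept elements))))
    where
    kept : neighbours a S ⊆ᵇ neighbours (removeEdge a x₀ y₀) S
    kept y ny with gy , x , sx , axy ← neighbours⁻ a S ny =
      neighbours⁺ (removeEdge a x₀ y₀) S gy sx (removeEdge-keeps a (inj₁ x≢x₀) axy)
      where
      x≢x₀ : x ≢ x₀
      x≢x₀ refl with () ← trans (sym sx) sx₀

  neighbours-∪-⊆ : ∀ a {x₀ y₁ y₂ S₁ S₂} → y₁ ≢ y₂ → S₁ x₀ ≡ true → S₂ x₀ ≡ true →
    neighbours a (S₁ ∪ᵇ S₂) ⊆ᵇ (neighbours (removeEdge a x₀ y₁) S₁ ∪ᵇ neighbours (removeEdge a x₀ y₂) S₂)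
  neighbours-∪-⊆ a {x₀} {y₁} {y₂} {S₁} {S₂} y₁≢y₂ x₀∈S₁ x₀∈S₂ y ny
    with gy , x , x∈S₁∪S₂ , axy ← neighbours⁻ a (S₁ ∪ᵇ S₂) ny = edge∈N₁∪N₂ gy x∈S₁∪S₂ axy
    where
    a₁ a₂ : Adjacency
    a₁ = removeEdge a x₀ y₁
    a₂ = removeEdge a x₀ y₂
    N₁ N₂ : X → Bool
    N₁ = neighbours a₁ S₁
    N₂ = neighbours a₂ S₂

    edge∈N₁∪N₂ : ∀ {x y} → G y ≡ true → (S₁ ∪ᵇ S₂) x ≡ true → a x y ≡ true → (N₁ ∪ᵇ N₂) y ≡ true
    edge∈N₁∪N₂ {x} {y} gy x∈S₁∪S₂ axy with x ≟ x₀
    ... | no x≢x₀ with ∨-true⁻ {S₁ x} x∈S₁∪S₂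
    ...   | inj₁ sx = ∨-trueˡ _ (neighbours⁺ a₁ S₁ gy sx (removeEdge-keeps a (inj₁ x≢x₀) axy))
    ...   | inj₂ sx = ∨-trueʳ (N₁ y) (neighbours⁺ a₂ S₂ gy sx (removeEdge-keeps a (inj₁ x≢x₀) axy))
    -- Testing y₁ ≟ y rather than y ≟ y₁ keeps the goal, which mentions y ≟ y₁, unabstracted.
    edge∈N₁∪N₂ {y = y} gy _ axy | yes refl with y₁ ≟ y
    ... | no y₁≢y = ∨-trueˡ _ (neighbours⁺ a₁ S₁ gy x₀∈S₁ (removeEdge-keeps a (inj₂ (≢-sym y₁≢y)) axy))
    ... | yes refl = ∨-trueʳ (N₁ y) (neighbours⁺ a₂ S₂ gy x₀∈S₂ (removeEdge-keeps a (inj₂ y₁≢y₂) axy))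

  neighbours-∩-⊆ : ∀ a {x₀ y₁ y₂ S₁ S₂} →
    neighbours a ((S₁ ∩ᵇ S₂) ∖｛ x₀ ｝) ⊆ᵇ
      (neighbours (removeEdge a x₀ y₁) S₁ ∩ᵇ neighbours (removeEdge a x₀ y₂) S₂)
  neighbours-∩-⊆ a {x₀} {y₁} {y₂} {S₁} {S₂} y ny
    with gy , x , x∈I , axy ← neighbours⁻ a ((S₁ ∩ᵇ S₂) ∖｛ x₀ ｝) ny
    with x∈S₁∩S₂ , x≢x₀ ← ∈∖｛｝⁻ (S₁ ∩ᵇ S₂) x∈I
    with sx₁ , sx₂ ← ∧-true⁻ {S₁ x} x∈S₁∩S₂ =
    ∧-true⁺ (neighbours⁺ (removeEdge a x₀ y₁) S₁ gy sx₁ (removeEdge-keeps a (inj₁ x≢x₀) axy))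
            (neighbours⁺ (removeEdge a x₀ y₂) S₂ gy sx₂ (removeEdge-keeps a (inj₁ x≢x₀) axy))

  -- |N(·)| is submodular, and the edge lost at x₀ in one graph is present in the other since y₁ ≢ y₂.
  not-both-deficient : ∀ a {x₀ y₁ y₂ S₁ S₂} → HallCondition a → y₁ ≢ y₂ →
    Deficient (removeEdge a x₀ y₁) S₁ → ¬ Deficient (removeEdge a x₀ y₂) S₂
  not-both-deficient a {x₀} {y₁} {y₂} {S₁} {S₂} hall-a y₁≢y₂ d₁@(S₁⊆F , N₁<S₁) d₂@(S₂⊆F , N₂<S₂) =
    1+n≰n (begin
      suc (suc (# N₁ + # N₂))                    ≡⟨ cong suc (+-suc (# N₁) (# N₂)) ⟨
      suc (# N₁) + suc (# N₂)                    ≤⟨ +-mono-≤ N₁<S₁ N₂<S₂ ⟩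
      # S₁ + # S₂                                ≡⟨ count-∪-∩ S₁ S₂ elements ⟨
      # (S₁ ∪ᵇ S₂) + # (S₁ ∩ᵇ S₂)                ≤⟨ +-monoʳ-≤ (# (S₁ ∪ᵇ S₂)) (#≤#∖｛｝+1 (S₁ ∩ᵇ S₂) x₀) ⟩
      # (S₁ ∪ᵇ S₂) + (# I + 1)                   ≤⟨ +-mono-≤ (hall-a (S₁ ∪ᵇ S₂) ∪⊆F) (+-monoˡ-≤ 1 (hall-a I I⊆F)) ⟩
      # (neighbours a (S₁ ∪ᵇ S₂)) + (# (neighbours a I) + 1)
        ≤⟨ +-mono-≤ (count-mono (neighbours-∪-⊆ a {S₁ = S₁} {S₂} y₁≢y₂ x₀∈S₁ x₀∈S₂) elements)
                    (+-monoˡ-≤ 1 (count-mono (neighbours-∩-⊆ a {x₀} {y₁} {y₂} {S₁} {S₂}) elements)) ⟩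
      # (N₁ ∪ᵇ N₂) + (# (N₁ ∩ᵇ N₂) + 1)           ≡⟨ +-assoc (# (N₁ ∪ᵇ N₂)) _ 1 ⟨
      (# (N₁ ∪ᵇ N₂) + # (N₁ ∩ᵇ N₂)) + 1           ≡⟨ cong (_+ 1) (count-∪-∩ N₁ N₂ elements) ⟩
      (# N₁ + # N₂) + 1                          ≡⟨ +-comm _ 1 ⟩
      suc (# N₁ + # N₂)                          ∎)
    where
    open ≤-Reasoning
    N₁ N₂ I : X → Bool
    N₁ = neighbours (removeEdge a x₀ y₁) S₁
    N₂ = neighbours (removeEdge a x₀ y₂) S₂
    I = (S₁ ∩ᵇ S₂) ∖｛ x₀ ｝

    x₀∈S₁ : S₁ x₀ ≡ true
    x₀∈S₁ = deficient-after-removal-∋ a hall-a d₁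
    x₀∈S₂ : S₂ x₀ ≡ true
    x₀∈S₂ = deficient-after-removal-∋ a hall-a d₂

    ∪⊆F : (S₁ ∪ᵇ S₂) ⊆ᵇ F
    ∪⊆F x h with ∨-true⁻ {S₁ x} h
    ... | inj₁ sx = S₁⊆F x sx
    ... | inj₂ sx = S₂⊆F x sx

    I⊆F : I ⊆ᵇ F
    I⊆F x h = S₁⊆F x (proj₁ (∧-true⁻ {S₁ x} (proj₁ (∈∖｛｝⁻ (S₁ ∩ᵇ S₂) h))))

  -- `fuel` bounds the number of edges, which each removal decreases.
  hall-by-edge-removal : ∀ fuel a → size a < fuel → HallCondition a → Matching a
  hall-by-edge-removal (suc fuel) a size<fuel hall-a with degree≤1-or-branching a
  ... | inj₁ deg≤1 = degree≤1⇒matching a hall-a deg≤1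
  ... | inj₂ (x₀ , fx₀ , 2≤deg) = remove-one-of (two-distinct 2≤deg)
    where
    remove : ∀ y → G y ∧ a x₀ y ≡ true → HallCondition (removeEdge a x₀ y) → Matching a
    remove y e hall′ with gy , ax₀y ← ∧-true⁻ {G y} e =
      Matching-mono (removeEdge-⊆ a x₀ y) (hall-by-edge-removal fuel (removeEdge a x₀ y)
        (≤-trans (size-removeEdge a fx₀ gy ax₀y) (≤-pred size<fuel)) hall′)

    remove-one-of : (∃ λ y₁ → ∃ λ y₂ → y₁ ≢ y₂ × G y₁ ∧ a x₀ y₁ ≡ true × G y₂ ∧ a x₀ y₂ ≡ true) → Matching a
    remove-one-of (y₁ , y₂ , y₁≢y₂ , e₁ , e₂)
      with hallCondition-or-deficient (removeEdge a x₀ y₁) | hallCondition-or-deficient (removeEdge a x₀ y₂)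
    ... | inj₁ hall₁ | _ = remove y₁ e₁ hall₁
    ... | inj₂ _ | inj₁ hall₂ = remove y₂ e₂ hall₂
    ... | inj₂ (_ , d₁) | inj₂ (_ , d₂) = ⊥-elim (not-both-deficient a hall-a y₁≢y₂ d₁ d₂)

  hall : ∀ a → HallCondition a → Matching a
  hall a = hall-by-edge-removal (suc (size a)) a ≤-refl

infix 4 _≟ˢ_
_≟ˢ_ : ∀ {n} → DecidableEquality (Subset n)
_≟ˢ_ = ≡-dec _≟ᵇ_

∈-allSubsets : ∀ {n} (A : Subset n) → A ∈ allSubsets n
∈-allSubsets [] = here refl
∈-allSubsets {suc n} (true ∷ A) = ∈-++⁺ˡ (∈-map⁺ (true ∷_) (∈-allSubsets A))
∈-allSubsets {suc n} (false ∷ A) = ∈-++⁺ʳ (map (true ∷_) (allSubsets n)) (∈-map⁺ (false ∷_) (∈-allSubsets A))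

∣_∣ : ∀ {n} → Family n → ℕ
∣ 𝓕 ∣ = count 𝓕 (allSubsets _)

_↾_ : ∀ {n} → Family (suc n) → Bool → Family n
(𝓕 ↾ b) A = 𝓕 (b ∷ A)

∣∣-suc : ∀ {n} (𝓕 : Family (suc n)) → ∣ 𝓕 ∣ ≡ ∣ 𝓕 ↾ true ∣ + ∣ 𝓕 ↾ false ∣
∣∣-suc {n} 𝓕 = trans (count-++ 𝓕 (map (true ∷_) (allSubsets n)) _)
  (cong₂ _+_ (count-map 𝓕 (true ∷_) (allSubsets n)) (count-map 𝓕 (false ∷_) (allSubsets n)))

allSubsets-once : ∀ {n} (B : Subset n) → ∣ (λ A → does (A ≟ˢ B)) ∣ ≡ 1
allSubsets-once [] = refl
allSubsets-once {suc n} (true ∷ B)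
  rewrite ∣∣-suc (λ A → does (A ≟ˢ (true ∷ B))) | allSubsets-once B | count-false (allSubsets n) = refl
allSubsets-once {suc n} (false ∷ B)
  rewrite ∣∣-suc (λ A → does (A ≟ˢ (false ∷ B))) | allSubsets-once B | count-false (allSubsets n) = refl

card≡∣∣ : ∀ {n} (𝓕 : Family n) → card 𝓕 ≡ ∣ 𝓕 ∣
card≡∣∣ {n} 𝓕 = go (allSubsets n)
  where
  go : ∀ As → length (filter (λ A → 𝓕 A ≟ᵇ true) As) ≡ count 𝓕 As
  go [] = refl
  go (A ∷ As) with 𝓕 A
  ... | true = cong suc (go As)
  ... | false = go As

IsUpSet : ∀ {n} → Family n → Set
IsUpSet {n} 𝓤 = ∀ (A B : Subset n) → A ∈F 𝓤 → A ⊆ B → B ∈F 𝓤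

IsDownSet-↾ : ∀ {n} {𝓓 : Family (suc n)} b → IsDownSet 𝓓 → IsDownSet (𝓓 ↾ b)
IsDownSet-↾ b down A B B∈𝓓 A⊆B = down (b ∷ A) (b ∷ B) B∈𝓓 (s⊆s A⊆B)

IsUpSet-↾ : ∀ {n} {𝓤 : Family (suc n)} b → IsUpSet 𝓤 → IsUpSet (𝓤 ↾ b)
IsUpSet-↾ b up A B A∈𝓤 A⊆B = up (b ∷ A) (b ∷ B) A∈𝓤 (s⊆s A⊆B)

IsDownSet-∣↾∣ : ∀ {n} {𝓓 : Family (suc n)} → IsDownSet 𝓓 → ∣ 𝓓 ↾ true ∣ ≤ ∣ 𝓓 ↾ false ∣
IsDownSet-∣↾∣ down = count-mono (λ A A∈ → down (false ∷ A) (true ∷ A) A∈ (out⊆ ⊆-refl)) (allSubsets _)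

IsUpSet-∣↾∣ : ∀ {n} {𝓤 : Family (suc n)} → IsUpSet 𝓤 → ∣ 𝓤 ↾ false ∣ ≤ ∣ 𝓤 ↾ true ∣
IsUpSet-∣↾∣ up = count-mono (λ A A∈ → up (false ∷ A) (true ∷ A) A∈ (out⊆ ⊆-refl)) (allSubsets _)

∣∘∁∣ : ∀ n (𝓕 : Family n) → ∣ (λ A → 𝓕 (∁ A)) ∣ ≡ ∣ 𝓕 ∣
∣∘∁∣ zero 𝓕 = refl
∣∘∁∣ (suc n) 𝓕 rewrite ∣∣-suc (λ A → 𝓕 (∁ A)) | ∣∣-suc 𝓕
  | ∣∘∁∣ n (𝓕 ↾ false) | ∣∘∁∣ n (𝓕 ↾ true) = +-comm ∣ 𝓕 ↾ false ∣ _

-- Kleitman's correlation inequalities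

rearrangement : ∀ {a b c d} → a ≤ b → c ≤ d → a * d + b * c ≤ a * c + b * d
rearrangement {a} {b} {c} {d} a≤b c≤d
  with x , refl ← m≤n⇒∃[o]m+o≡n a≤b | y , refl ← m≤n⇒∃[o]m+o≡n c≤d =
  subst (a * (c + y) + (a + x) * c ≤_) (sym (expand a x c y)) (m≤m+n _ (x * y))
  where
  expand : ∀ a x c y → a * c + (a + x) * (c + y) ≡ (a * (c + y) + (a + x) * c) + x * y
  expand = solve-∀

product-of-sums : ∀ a₁ a₀ b₁ b₀ → (a₁ + a₀) * (b₁ + b₀) ≡ (a₁ * b₁ + a₀ * b₀) + (a₁ * b₀ + a₀ * b₁)
product-of-sums = solve-∀

double-sum : ∀ k c₁ c₀ → 2 * k * (c₁ + c₀) ≡ (k * c₁ + k * c₀) + (k * c₁ + k * c₀)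
double-sum = solve-∀

kleitman-step-≤ : ∀ {a₁ a₀ b₁ b₀ k c₁ c₀} → a₁ ≤ a₀ → b₁ ≤ b₀ → a₁ * b₁ ≤ k * c₁ → a₀ * b₀ ≤ k * c₀ →
  (a₁ + a₀) * (b₁ + b₀) ≤ 2 * k * (c₁ + c₀)
kleitman-step-≤ {a₁} {a₀} {b₁} {b₀} {k} {c₁} {c₀} a₁≤a₀ b₁≤b₀ ≤kc₁ ≤kc₀ = begin
  (a₁ + a₀) * (b₁ + b₀)                          ≡⟨ product-of-sums a₁ a₀ b₁ b₀ ⟩
  (a₁ * b₁ + a₀ * b₀) + (a₁ * b₀ + a₀ * b₁)        ≤⟨ +-monoʳ-≤ (a₁ * b₁ + a₀ * b₀) (rearrangement a₁≤a₀ b₁≤b₀) ⟩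
  (a₁ * b₁ + a₀ * b₀) + (a₁ * b₁ + a₀ * b₀)        ≤⟨ +-mono-≤ (+-mono-≤ ≤kc₁ ≤kc₀) (+-mono-≤ ≤kc₁ ≤kc₀) ⟩
  (k * c₁ + k * c₀) + (k * c₁ + k * c₀)            ≡⟨ double-sum k c₁ c₀ ⟨
  2 * k * (c₁ + c₀)                              ∎
  where open ≤-Reasoning

kleitman-step-≥ : ∀ {a₁ a₀ u₁ u₀ k c₁ c₀} → a₁ ≤ a₀ → u₀ ≤ u₁ → k * c₁ ≤ a₁ * u₁ → k * c₀ ≤ a₀ * u₀ →
  2 * k * (c₁ + c₀) ≤ (a₁ + a₀) * (u₁ + u₀)
kleitman-step-≥ {a₁} {a₀} {u₁} {u₀} {k} {c₁} {c₀} a₁≤a₀ u₀≤u₁ kc₁≤ kc₀≤ = begin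
  2 * k * (c₁ + c₀)                              ≡⟨ double-sum k c₁ c₀ ⟩
  (k * c₁ + k * c₀) + (k * c₁ + k * c₀)            ≤⟨ +-mono-≤ (+-mono-≤ kc₁≤ kc₀≤) (+-mono-≤ kc₁≤ kc₀≤) ⟩
  (a₁ * u₁ + a₀ * u₀) + (a₁ * u₁ + a₀ * u₀)        ≤⟨ +-monoʳ-≤ (a₁ * u₁ + a₀ * u₀) (rearrangement a₁≤a₀ u₀≤u₁) ⟩
  (a₁ * u₁ + a₀ * u₀) + (a₁ * u₀ + a₀ * u₁)        ≡⟨ product-of-sums a₁ a₀ u₁ u₀ ⟨
  (a₁ + a₀) * (u₁ + u₀)                          ∎
  where open ≤-Reasoning

kleitman-down-down : ∀ n (𝓐 𝓑 : Family n) → IsDownSet 𝓐 → IsDownSet 𝓑 →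
  ∣ 𝓐 ∣ * ∣ 𝓑 ∣ ≤ 2 ^ n * ∣ 𝓐 ∩ᵇ 𝓑 ∣
kleitman-down-down zero 𝓐 𝓑 _ _ with 𝓐 [] | 𝓑 []
... | true  | true  = ≤-refl
... | true  | false = z≤n
... | false | _     = z≤n
kleitman-down-down (suc n) 𝓐 𝓑 down-𝓐 down-𝓑
  rewrite ∣∣-suc 𝓐 | ∣∣-suc 𝓑 | ∣∣-suc (𝓐 ∩ᵇ 𝓑) =
  kleitman-step-≤ {k = 2 ^ n} (IsDownSet-∣↾∣ down-𝓐) (IsDownSet-∣↾∣ down-𝓑)
    (kleitman-down-down n _ _ (IsDownSet-↾ true down-𝓐) (IsDownSet-↾ true down-𝓑))
    (kleitman-down-down n _ _ (IsDownSet-↾ false down-𝓐) (IsDownSet-↾ false down-𝓑))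

kleitman-down-up : ∀ n (𝓐 𝓤 : Family n) → IsDownSet 𝓐 → IsUpSet 𝓤 →
  2 ^ n * ∣ 𝓐 ∩ᵇ 𝓤 ∣ ≤ ∣ 𝓐 ∣ * ∣ 𝓤 ∣
kleitman-down-up zero 𝓐 𝓤 _ _ with 𝓐 [] | 𝓤 []
... | true  | true  = ≤-refl
... | true  | false = z≤n
... | false | _     = z≤n
kleitman-down-up (suc n) 𝓐 𝓤 down-𝓐 up-𝓤
  rewrite ∣∣-suc 𝓐 | ∣∣-suc 𝓤 | ∣∣-suc (𝓐 ∩ᵇ 𝓤) =
  kleitman-step-≥ {k = 2 ^ n} (IsDownSet-∣↾∣ down-𝓐) (IsUpSet-∣↾∣ up-𝓤)
    (kleitman-down-up n _ _ (IsDownSet-↾ true down-𝓐) (IsUpSet-↾ true up-𝓤))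
    (kleitman-down-up n _ _ (IsDownSet-↾ false down-𝓐) (IsUpSet-↾ false up-𝓤))

-- Hall's condition in the bipartite Kneser graph of two down-sets

disjoint? : ∀ {n} → Subset n → Subset n → Bool
disjoint? A B = does (A ∩ B ≟ˢ ⊥)

disjoint?-sound : ∀ {n} {A B : Subset n} → disjoint? A B ≡ true → A ∩ B ≡ ⊥
disjoint?-sound {A = A} {B} h with A ∩ B ≟ˢ ⊥
... | yes A∩B≡⊥ = A∩B≡⊥

disjoint?-∁ : ∀ {n} (A : Subset n) → disjoint? A (∁ A) ≡ true
disjoint?-∁ A = dec-true (A ∩ ∁ A ≟ˢ ⊥) (∩-inverseʳ A)

disjoint?-antitone : ∀ {n} (A : Subset n) {B B′} → B′ ⊆ B → disjoint? A B ≡ true → disjoint? A B′ ≡ true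
disjoint?-antitone A {B} {B′} B′⊆B h = dec-true (A ∩ B′ ≟ˢ ⊥) (Empty-unique λ (x , x∈A∩B′) →
  let x∈A , x∈B′ = x∈p∩q⁻ A B′ x∈A∩B′
  in ∉⊥ (subst (x ∈ˢ_) (disjoint?-sound h) (x∈p∩q⁺ (x∈A , B′⊆B x∈B′))))

module KneserGraph {n} (𝓕 𝓖 : Family n) = Hall _≟ˢ_ (allSubsets n) ∈-allSubsets allSubsets-once 𝓕 𝓖

kneser-hallCondition : ∀ {n} (𝓕 𝓖 : Family n) → IsDownSet 𝓕 → IsDownSet 𝓖 → ∣ 𝓕 ∣ ≤ ∣ 𝓖 ∣ →
  KneserGraph.HallCondition 𝓕 𝓖 disjoint?
kneser-hallCondition {n} 𝓕 𝓖 down-𝓕 down-𝓖 ∣𝓕∣≤∣𝓖∣ S S⊆𝓕 = *-cancelˡ-≤ (2 ^ n) {{m^n≢0 2 n}} (begin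
  2 ^ n * ∣ S ∣           ≤⟨ *-monoʳ-≤ (2 ^ n) (count-mono S⊆𝓕∩𝓤 (allSubsets n)) ⟩
  2 ^ n * ∣ 𝓕 ∩ᵇ 𝓤 ∣       ≤⟨ kleitman-down-up n 𝓕 𝓤 down-𝓕 up-𝓤 ⟩
  ∣ 𝓕 ∣ * ∣ 𝓤 ∣            ≡⟨ cong (∣ 𝓕 ∣ *_) (∣∘∁∣ n 𝓓) ⟩
  ∣ 𝓕 ∣ * ∣ 𝓓 ∣            ≤⟨ *-monoˡ-≤ ∣ 𝓓 ∣ ∣𝓕∣≤∣𝓖∣ ⟩
  ∣ 𝓖 ∣ * ∣ 𝓓 ∣            ≤⟨ kleitman-down-down n 𝓖 𝓓 down-𝓖 down-𝓓 ⟩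
  2 ^ n * ∣ 𝓖 ∩ᵇ 𝓓 ∣       ∎)
  where
  open ≤-Reasoning
  𝓓 𝓤 : Family n
  𝓓 B = any (λ A → S A ∧ disjoint? A B) (allSubsets n)
  𝓤 A = 𝓓 (∁ A)

  down-𝓓 : IsDownSet 𝓓
  down-𝓓 B′ B B∈𝓓 B′⊆B with A , _ , A∈S∧disj ← any-true⁻ (allSubsets n) B∈𝓓
    with A∈S , disj ← ∧-true⁻ {S A} A∈S∧disj =
    any-true⁺ (∈-allSubsets A) (∧-true⁺ A∈S (disjoint?-antitone A B′⊆B disj))

  up-𝓤 : IsUpSet 𝓤
  up-𝓤 A A′ A∈𝓤 A⊆A′ = down-𝓓 (∁ A′) (∁ A) A∈𝓤 (p⊆q⇒∁p⊇∁q A⊆A′)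

  S⊆𝓕∩𝓤 : S ⊆ᵇ (𝓕 ∩ᵇ 𝓤)
  S⊆𝓕∩𝓤 A A∈S = ∧-true⁺ (S⊆𝓕 A A∈S) (any-true⁺ (∈-allSubsets A) (∧-true⁺ A∈S (disjoint?-∁ A)))

theorem5 : (n : ℕ) → 1 ≤ n → (𝓕 𝓖 : Family n) →
    IsDownSet 𝓕 → IsDownSet 𝓖 → card 𝓕 ≤ card 𝓖 →
    Σ ((A : Subset n) → A ∈F 𝓕 → Subset n) (λ φ →
      ((A : Subset n) (p : A ∈F 𝓕) → (φ A p ∈F 𝓖) × (A ∩ φ A p ≡ ⊥))
      × ((A B : Subset n) (p : A ∈F 𝓕) (q : B ∈F 𝓕) → φ A p ≡ φ B q → A ≡ B))
theorem5 n _ 𝓕 𝓖 down-𝓕 down-𝓖 card𝓕≤card𝓖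
  with φ , adjacent , injective ← KneserGraph.hall 𝓕 𝓖 disjoint?
         (kneser-hallCondition 𝓕 𝓖 down-𝓕 down-𝓖 (subst₂ _≤_ (card≡∣∣ 𝓕) (card≡∣∣ 𝓖) card𝓕≤card𝓖))
  = φ , (λ A p → proj₁ (adjacent A p) , disjoint?-sound (proj₂ (adjacent A p))) , injective
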